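{- Let $(L,\preceq)$ be a lattice and $\delta$ a local congruence on $L$. Then the relation $\preceq_\delta$ on $L/\delta$ is a partial order if and only if every $\delta$-cycle in $L$ is closed.
   Context: A local congruence on a lattice $(L,\preceq)$ is an equivalence relation $\delta$ on $L$ each of whose equivalence classes is a sublattice of $L$ and is convex (if $u,v$ are in a class and $u\preceq w\preceq v$, then $w$ is in that class). $[a]_\delta$ denotes the class of $a$ and $L/\delta$ the set of classes. A $\delta$-sequence from $p_0$ to $p_n$ is a finite sequence $(p_0,p_1,\dots,p_n)$, $n\ge1$, of elements of $L$ such that for each $i\in\{1,\dots,n\}$ either $(p_{i-1},p_i)\in\delta$ or $p_{i-1}\preceq p_i$. A $\delta$-cycle is a $\delta$-sequence with $p_0=p_n$; it is closed if $[p_0]_\delta=[p_1]_\delta=\dots=[p_n]_\delta$. The relation $\preceq_\delta$ on $L/\delta$ is defined by $[x]_\delta\preceq_\delta[y]_\delta$ iff there exist $x'\in[x]_\delta$, $y'\in[y]_\delta$ and a $\delta$-sequence from $x'$ to $y'$ (it is always reflexive and transitive). -}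

module Defs where

open import Level using (Level; _⊔_)
open import Data.Product using (Σ-syntax; _×_)
open import Relation.Binary.Core using (Rel)
open import Relation.Binary.Structures using (IsEquivalence; IsPartialOrder)
open import Relation.Binary.Lattice.Bundles using (Lattice)

module _ {c ℓ₁ ℓ₂ : Level} (L : Lattice c ℓ₁ ℓ₂) where
  open Lattice L

  record IsLocalCongruence {ℓ₃ : Level} (δ : Rel Carrier ℓ₃) : Set (c ⊔ ℓ₂ ⊔ ℓ₃) where
    field
      isEquivalence : IsEquivalence δ
      ∨-closed : ∀ {a x y} → δ x a → δ y a → δ (x ∨ y) a
      ∧-closed : ∀ {a x y} → δ x a → δ y a → δ (x ∧ y) a
      convex   : ∀ {u v w} → δ u v → u ≤ w → w ≤ v → δ u w

  module _ {ℓ₃ : Level} (δ : Rel Carrier ℓ₃) where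

    data Step (p q : Carrier) : Set (ℓ₂ ⊔ ℓ₃) where
      viaδ : δ p q → Step p q
      via≤ : p ≤ q → Step p q

    data DSeq : Carrier → Carrier → Set (c ⊔ ℓ₂ ⊔ ℓ₃) where
      single : ∀ {p q} → Step p q → DSeq p q
      cons   : ∀ {p q r} → Step p q → DSeq q r → DSeq p r

    AllInClassOf : Carrier → ∀ {p q} → DSeq p q → Set ℓ₃
    AllInClassOf a (single {p} {q} _) = δ p a × δ q a
    AllInClassOf a (cons {p} _ s) = δ p a × AllInClassOf a s

    IsClosedCycle : ∀ {p} → DSeq p p → Set ℓ₃
    IsClosedCycle {p} s = AllInClassOf p s

    EveryCycleClosed : Set (c ⊔ ℓ₂ ⊔ ℓ₃)
    EveryCycleClosed = ∀ {p} (s : DSeq p p) → IsClosedCycle s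

    -- [x] ≼δ [y], expressed on representatives.
    _≼δ_ : Rel Carrier (c ⊔ ℓ₂ ⊔ ℓ₃)
    x ≼δ y = Σ[ x' ∈ Carrier ] Σ[ y' ∈ Carrier ] (δ x' x × δ y' y × DSeq x' y')

    -- ≼δ is a partial order on L/δ: modelled on the carrier with δ as the
    -- equality (the setoid presentation of the quotient L/δ).
    QuotientPartialOrder : Set (c ⊔ ℓ₂ ⊔ ℓ₃)
    QuotientPartialOrder = IsPartialOrder δ _≼δ_

{-# OPTIONS --safe #-}
module Submission where

-- Every element q of a δ-cycle through p satisfies [p] ≼δ [q] ≼δ [p], so
-- antisymmetry forces q into [p]. Conversely, δ-sequences witnessing
-- [x] ≼δ [y] and [y] ≼δ [x] splice, through δ-steps, into one δ-cycle
-- passing through representatives of [x] and [y]; if it is closed, [x] = [y].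

open import Defs
open import Level using (Level)
open import Function.Bundles using (_⇔_; mk⇔)
open import Relation.Binary.Core using (Rel)
open import Relation.Binary.Definitions using (Antisymmetric; Transitive)
open import Relation.Binary.Lattice.Bundles using (Lattice)
open import Relation.Binary.Structures using (IsEquivalence; IsPreorder; IsPartialOrder)
open import Data.Product using (_,_; proj₁; proj₂)

module _ {c ℓ₁ ℓ₂ ℓ₃ : Level} (L : Lattice c ℓ₁ ℓ₂)
         (δ : Rel (Lattice.Carrier L) ℓ₃) (δ-isEquivalence : IsEquivalence δ) where

  open Lattice L using (Carrier)
  open IsEquivalence δ-isEquivalence
    renaming (refl to δ-refl; sym to δ-sym; trans to δ-trans)

  private
    _≼_ : Rel Carrier _
    _≼_ = _≼δ_ L δ

  _++_ : ∀ {p q r} → DSeq L δ p q → DSeq L δ q r → DSeq L δ p r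
  single st ++ t = cons st t
  cons st s ++ t = cons st (s ++ t)

  infixr 5 _⟨_⟩_

  _⟨_⟩_ : ∀ {p q q' r} → DSeq L δ p q → δ q q' → DSeq L δ q' r → DSeq L δ p r
  s ⟨ qq' ⟩ t = s ++ cons (viaδ qq') t

  DSeq⇒≼δ : ∀ {p q} → DSeq L δ p q → p ≼ q
  DSeq⇒≼δ {p} {q} s = p , q , δ-refl , δ-refl , s

  ≼δ-trans : Transitive _≼_
  ≼δ-trans (x' , y' , x'x , y'y , s) (y'' , z' , y''y , z'z , t) =
    x' , z' , x'x , z'z , s ⟨ δ-trans y'y (δ-sym y''y) ⟩ t

  ≼δ-isPreorder : IsPreorder δ _≼_
  ≼δ-isPreorder = record
    { isEquivalence = δ-isEquivalence
    ; reflexive     = λ {x} {y} xy → x , y , δ-refl , δ-refl , single (viaδ xy)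
    ; trans         = ≼δ-trans
    }

  AllInClassOf-head : ∀ {a p q} (s : DSeq L δ p q) → AllInClassOf L δ a s → δ p a
  AllInClassOf-head (single _) inClass = proj₁ inClass
  AllInClassOf-head (cons _ _) inClass = proj₁ inClass

  AllInClassOf-++-middle : ∀ {a p q r} (s : DSeq L δ p q) (t : DSeq L δ q r) →
                           AllInClassOf L δ a (s ++ t) → δ q a
  AllInClassOf-++-middle (single _) t inClass = AllInClassOf-head t (proj₂ inClass)
  AllInClassOf-++-middle (cons _ s) t inClass = AllInClassOf-++-middle s t (proj₂ inClass)

  module _ (antisym : Antisymmetric δ _≼_) where

    ≼δ-both-ways⇒δ : ∀ {p q} → p ≼ q → q ≼ p → δ q p
    ≼δ-both-ways⇒δ p≼q q≼p = δ-sym (antisym p≼q q≼p)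

    between-in-class : ∀ {p q r} (s : DSeq L δ q r) → p ≼ q → r ≼ p →
                       AllInClassOf L δ p s
    between-in-class s@(single _) p≼q r≼p =
      ≼δ-both-ways⇒δ p≼q (≼δ-trans (DSeq⇒≼δ s) r≼p) ,
      ≼δ-both-ways⇒δ (≼δ-trans p≼q (DSeq⇒≼δ s)) r≼p
    between-in-class s@(cons st rest) p≼q r≼p =
      ≼δ-both-ways⇒δ p≼q (≼δ-trans (DSeq⇒≼δ s) r≼p) ,
      between-in-class rest (≼δ-trans p≼q (DSeq⇒≼δ (single st))) r≼p

    antisymmetric⇒everyCycleClosed : EveryCycleClosed L δ
    antisymmetric⇒everyCycleClosed s =
      between-in-class s (IsPreorder.refl ≼δ-isPreorder) (IsPreorder.refl ≼δ-isPreorder)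

  everyCycleClosed⇒antisymmetric : EveryCycleClosed L δ → Antisymmetric δ _≼_
  everyCycleClosed⇒antisymmetric closed (x' , y' , x'x , y'y , s) (y'' , x'' , y''y , x''x , t) =
    δ-trans (δ-sym x'x) (δ-trans (δ-sym y'x') y'y)
    where
    cycle : DSeq L δ x' x'
    cycle = s ⟨ δ-trans y'y (δ-sym y''y) ⟩ t ++ single (viaδ (δ-trans x''x (δ-sym x'x)))
    y'x' : δ y' x'
    y'x' = AllInClassOf-++-middle s _ (closed cycle)

  isPartialOrder⇔everyCycleClosed : QuotientPartialOrder L δ ⇔ EveryCycleClosed L δ
  isPartialOrder⇔everyCycleClosed = mk⇔ isPartialOrder⇒closed closed⇒isPartialOrder
    where
    isPartialOrder⇒closed : QuotientPartialOrder L δ → EveryCycleClosed L δ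
    isPartialOrder⇒closed isPartialOrder =
      antisymmetric⇒everyCycleClosed (IsPartialOrder.antisym isPartialOrder)

    closed⇒isPartialOrder : EveryCycleClosed L δ → QuotientPartialOrder L δ
    closed⇒isPartialOrder closed = record
      { isPreorder = ≼δ-isPreorder
      ; antisym    = everyCycleClosed⇒antisymmetric closed
      }

theorem24 : {c ℓ₁ ℓ₂ ℓ₃ : Level} (L : Lattice c ℓ₁ ℓ₂)
    (δ : Rel (Lattice.Carrier L) ℓ₃) → IsLocalCongruence L δ →
    QuotientPartialOrder L δ ⇔ EveryCycleClosed L δ
theorem24 L δ isLocalCongruence =
  isPartialOrder⇔everyCycleClosed L δ (IsLocalCongruence.isEquivalence isLocalCongruence)
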